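{- Let $V=(v_1,\dots,v_d)$ and $U=(u_1,\dots,u_d)$ be non-increasing sequences of positive integers and $UV=(u_1v_1,\dots,u_dv_d)$. Then: (i) $T^i_V\,\widehat{\otimes}\,T^j_U=T^{\min\{i,j\}}_{UV}$ for all $0\le i,j\le d$; (ii) $T^i_V\,\widehat{\otimes}\,\{T_U\}=T^i_{UV}=T^i_U\,\widehat{\otimes}\,\{T_V\}$ for all $0\le i\le d$. (Equalities are up to isomorphism of rooted trees.)
   Context: Graphs are directed. $\bullet$ is the one-vertex rooted tree; $k\times G$ is $k$ disjoint copies of $G$, $\oplus$ is disjoint union. For a forest $G=T_1\oplus\cdots\oplus T_k$ of rooted trees, $\langle G\rangle$ is the rooted tree whose root has exactly $k$ predecessors, the $i$-th being the root of a copy of $T_i$ (edges point toward the root). For a rooted tree $T$, $\{T\}$ is $T$ with a loop added at the root. For a non-increasing sequence $W=(w_1,\dots,w_d)$ of positive integers define $T^0_W=\bullet$, $T^k_W=\langle w_k\times T^{k-1}_W\oplus\bigoplus_{i=1}^{k-1}(w_i-w_{i+1})\times T^{i-1}_W\rangle$ for $1\le k\le d$, and $T_W=\langle(w_d-1)\times T^{d-1}_W\oplus\bigoplus_{i=1}^{d-1}(w_i-w_{i+1})\times T^{i-1}_W\rangle$. The tensor product $G_1\otimes G_2$ of directed graphs has vertex set $V_{G_1}\times V_{G_2}$ and an edge $(v_1,v_2)\to(w_1,w_2)$ iff $v_i\to w_i$ is an edge of $G_i$ for $i=1,2$. For rooted trees $T,T'$ with roots $r_T,r_{T'}$ and $T_1\in\{T,\{T\}\}$,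 $T_2\in\{T',\{T'\}\}$, the restricted tensor product $T_1\widehat\otimes T_2$ is the connected component of $T_1\otimes T_2$ containing $(r_T,r_{T'})$, regarded (when it is a tree) as rooted at $(r_T,r_{T'})$. -}

module Defs where

open import Data.Nat using (ℕ; zero; suc; _∸_; _*_; _<_; _≥_)
open import Data.Fin using (Fin)
open import Data.List using (List; []; _∷_; _++_; replicate; length; lookup)
open import Data.Vec as Vec using (Vec)
open import Data.Vec.Relation.Unary.All using (All)
open import Data.Vec.Relation.Unary.Linked using (Linked)
open import Data.Product using (_×_; _,_; proj₁; proj₂)
open import Data.Sum using (_⊎_)
open import Data.Unit using (⊤)
open import Relation.Binary.PropositionalEquality using (_≡_)
open import Relation.Binary.Construct.Closure.Equivalence using (EqClosure)

record Graph : Set₁ where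
  field
    V : Set
    E : V → V → Set

record RGraph : Set₁ where
  field
    graph : Graph
    root  : Graph.V graph
  open Graph graph public

open RGraph

_⊗_ : Graph → Graph → Graph
G ⊗ H = record
  { V = Graph.V G × Graph.V H
  ; E = λ { (v₁ , v₂) (w₁ , w₂) → Graph.E G v₁ w₁ × Graph.E H v₂ w₂ } }

-- vertex of the connected component of G containing v
-- (connectivity proof irrelevant, so a vertex is determined by its
--  underlying vertex of G)
record CompV (G : Graph) (v : Graph.V G) : Set where
  constructor cv
  field
    vtx : Graph.V G
    .conn : EqClosure (Graph.E G) v vtx

component : (G : Graph) → Graph.V G → RGraph
component G v = record
  { graph = record
      { V = CompV G v
      ; E = λ a b → Graph.E G (CompV.vtx a) (CompV.vtx b) }
  ; root = cv v (EqClosure-refl) }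
  where
    open import Relation.Binary.Construct.Closure.ReflexiveTransitive using (ε)
    EqClosure-refl : EqClosure (Graph.E G) v v
    EqClosure-refl = ε

record _≅_ (G H : RGraph) : Set where
  field
    to      : V G → V H
    from    : V H → V G
    from∘to : ∀ x → from (to x) ≡ x
    to∘from : ∀ y → to (from y) ≡ y
    edge⇒   : ∀ {a b} → E G a b → E H (to a) (to b)
    edge⇐   : ∀ {a b} → E H (to a) (to b) → E G a b
    root≡   : to (root G) ≡ root H

data Tree : Set where
  node : List Tree → Tree

• : Tree
• = node []

⟨_⟩ : List Tree → Tree
⟨ ts ⟩ = node ts

_×ᵗ_ : ℕ → Tree → List Tree
k ×ᵗ t = replicate k t

data Pos : Tree → Set where
  here  : ∀ {ts} → Pos (node ts)
  below : ∀ {ts} (i : Fin (length ts)) → Pos (lookup ts i) → Pos (node ts)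

rootPos : (t : Tree) → Pos t
rootPos (node _) = here

-- edges point toward the root
data Edge : {t : Tree} → Pos t → Pos t → Set where
  toRoot : ∀ {ts} (i : Fin (length ts)) →
           Edge {node ts} (below i (rootPos (lookup ts i))) here
  inside : ∀ {ts} (i : Fin (length ts)) {p q : Pos (lookup ts i)} →
           Edge p q → Edge {node ts} (below i p) (below i q)

treeGraph : Tree → Graph
treeGraph t = record { V = Pos t ; E = Edge }

treeR : Tree → RGraph
treeR t = record { graph = treeGraph t ; root = rootPos t }

-- the directed graph of {T}: T with a loop added at the root
loopGraph : Tree → Graph
loopGraph t = record
  { V = Pos t
  ; E = λ a b → Edge a b ⊎ (a ≡ rootPos t × b ≡ rootPos t) }

restrictedTensor : (G₁ : Graph) (r₁ : Graph.V G₁) (G₂ : Graph) (r₂ : Graph.V G₂) → RGraph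
restrictedTensor G₁ r₁ G₂ r₂ = component (G₁ ⊗ G₂) (r₁ , r₂)

_⊗̂_ : Tree → Tree → RGraph
t ⊗̂ t' = restrictedTensor (treeGraph t) (rootPos t) (treeGraph t') (rootPos t')

-- T ⊗̂ {T'}  (written T ⊗̂ₗ T')
_⊗̂ₗ_ : Tree → Tree → RGraph
t ⊗̂ₗ t' = restrictedTensor (treeGraph t) (rootPos t) (loopGraph t') (rootPos t')

-- The trees T^k_W and T_W.  A sequence W = (w₁,…,w_d) is a Vec ℕ d;
-- w at i is the 1-based entry w_i (only used for 1 ≤ i ≤ d).

_at_ : ∀ {d} → Vec ℕ d → ℕ → ℕ
_at_ {zero} _ _ = 0
_at_ {suc d} (x Vec.∷ xs) zero = 0
_at_ {suc d} (x Vec.∷ xs) (suc zero) = x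
_at_ {suc d} (x Vec.∷ xs) (suc (suc i)) = xs at (suc i)

-- aux W k = ( T^k_W , ⊕_{i=1}^{k} (w_i - w_{i+1}) × T^{i-1}_W )
aux : ∀ {d} → Vec ℕ d → ℕ → Tree × List Tree
aux W zero = • , []
aux W (suc k) =
  ⟨ (W at suc k) ×ᵗ proj₁ (aux W k) ++ proj₂ (aux W k) ⟩ ,
  proj₂ (aux W k) ++ ((W at suc k ∸ W at suc (suc k)) ×ᵗ proj₁ (aux W k))

T^ : ∀ {d} → Vec ℕ d → ℕ → Tree
T^ W k = proj₁ (aux W k)

T_ : ∀ {d} → Vec ℕ (suc d) → Tree
T_ {d} W = ⟨ (W at suc d ∸ 1) ×ᵗ proj₁ (aux W d) ++ proj₂ (aux W d) ⟩

NonIncPos : ∀ {d} → Vec ℕ d → Set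
NonIncPos W = All (λ x → 0 < x) W × Linked _≥_ W

_·_ : ∀ {d} → Vec ℕ d → Vec ℕ d → Vec ℕ d
U · V = Vec.zipWith _*_ U V

{-# OPTIONS --safe #-}
-- The root of s ⊗̂ t has one child for every pair of children of the roots of s and t, the
-- subtree there being the restricted tensor product of the two child subtrees: a vertex (p, q)
-- of s ⊗ t is connected to the root pair iff p and q lie at the same depth. With a loop at the
-- root of t the condition becomes depth q ≤ depth p, and every child c of the root of s
-- contributes one more child, c ⊗̂ {t}. So both parts follow by induction on i, once the children
-- are counted by height. Among the children of T^k_W exactly w_{m+1} have height ≥ m (m < k), by
-- telescoping; the heights of pairs combine by min, and the pairs of children of T^i_V and T^j_U
-- with minimal height ≥ m number v_{m+1} u_{m+1}, which is the count for T^{min(i,j)}_{UV}. In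
-- T^i_V ⊗̂ {T_U}, the extra children c ⊗̂ {T_U} play the part of the pairs of c with the u_d-th
-- copy of T^{d-1}_U that T_U lacks compared with T^d_U.

module Submission where

open import Defs
open import Data.Empty using (⊥-elim)
import Data.Empty.Irrelevant as Irrelevant
open import Data.Fin using (Fin; zero; suc)
open import Data.Fin.Properties using (+↔⊎; *↔×; ¬Fin0)
open import Data.List using (List; []; _∷_; _++_; replicate; length; lookup)
open import Data.List.Properties using (length-replicate)
open import Data.Nat using (ℕ; zero; suc; _+_; _*_; _∸_; _⊓_; _≤_; _≥_; _<_; z≤n; s≤s; s≤s⁻¹; _≟_)
open import Data.Nat.Induction using (<-rec)
open import Data.Nat.Properties
open import Data.Nat.Tactic.RingSolver using (solve-∀)
open import Data.Product using (_×_; Σ; _,_; proj₁; proj₂)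
open import Data.Product.Algebra using (×-cong; ×-distribˡ-⊎; ×-distribʳ-⊎)
open import Data.Sum using (_⊎_; inj₁; inj₂; [_,_]′; map₁)
import Data.Sum as Sum
open import Data.Sum.Algebra using (⊎-cong; ⊎-comm; ⊎-assoc)
open import Data.Sum.Properties using ([,]-map)
open import Data.Unit using (⊤; tt)
open import Data.Vec using (Vec; []; _∷_)
open import Data.Vec.Relation.Unary.All using (All; _∷_)
open import Data.Vec.Relation.Unary.Linked using (Linked; _∷_)
open import Function.Base using (_∘_; id)
open import Function.Bundles using (_↔_; Inverse; mk↔ₛ′)
open import Function.Properties.Inverse using (↔-refl; ↔-sym; ↔-trans)
open import Level using (0ℓ)
open import Relation.Binary.Construct.Closure.Equivalence using (EqClosure)
import Relation.Binary.Construct.Closure.Equivalence as EqClosure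
open import Relation.Binary.Construct.Closure.ReflexiveTransitive using (Star; ε; _◅_; _◅◅_)
import Relation.Binary.Construct.Closure.ReflexiveTransitive as Star
open import Relation.Binary.Construct.Closure.Symmetric using (fwd; bwd)
open import Relation.Binary.PropositionalEquality
import Relation.Binary.Reasoning.Base.Single as SingleReasoning
open import Relation.Nullary using (yes; no)

open RGraph

-- Isomorphisms of rooted graphs

mk≅ : ∀ {G H} (to : V G → V H) (from : V H → V G) →
      (∀ x → from (to x) ≡ x) → (∀ y → to (from y) ≡ y) →
      (∀ {a b} → E G a b → E H (to a) (to b)) →
      (∀ {a b} → E H a b → E G (from a) (from b)) →
      to (root G) ≡ root H → G ≅ H
mk≅ {G} to from from∘to to∘from to-edge from-edge root≡ = record
  { to = to ; from = from ; from∘to = from∘to ; to∘from = to∘from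
  ; edge⇒ = to-edge
  ; edge⇐ = λ {a} {b} e → subst₂ (E G) (from∘to a) (from∘to b) (from-edge e)
  ; root≡ = root≡ }

≅-refl : ∀ {G} → G ≅ G
≅-refl = mk≅ id id (λ _ → refl) (λ _ → refl) id id refl

≡⇒≅ : ∀ {G H} → G ≡ H → G ≅ H
≡⇒≅ refl = ≅-refl

≅-sym : ∀ {G H} → G ≅ H → H ≅ G
≅-sym {G} {H} f = mk≅ from to to∘from from∘to
  (λ {a} {b} e → edge⇐ (subst₂ (E H) (sym (to∘from a)) (sym (to∘from b)) e)) edge⇒
  (trans (cong from (sym root≡)) (from∘to (root G)))
  where open _≅_ f

≅-trans : ∀ {G H K} → G ≅ H → H ≅ K → G ≅ K
≅-trans f g = record
  { to = G.to ∘ F.to ; from = F.from ∘ G.from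
  ; from∘to = λ x → trans (cong F.from (G.from∘to _)) (F.from∘to x)
  ; to∘from = λ x → trans (cong G.to (F.to∘from _)) (G.to∘from x)
  ; edge⇒ = G.edge⇒ ∘ F.edge⇒
  ; edge⇐ = F.edge⇐ ∘ G.edge⇐
  ; root≡ = trans (cong G.to F.root≡) G.root≡ }
  where module F = _≅_ f
        module G = _≅_ g

module ≅-Reasoning = SingleReasoning _≅_ ≅-refl ≅-trans

module _ {I : Set} (F : I → RGraph) where

  NodeV : Set
  NodeV = ⊤ ⊎ Σ I (V ∘ F)

  data NodeE : NodeV → NodeV → Set where
    toRoot : ∀ i → NodeE (inj₂ (i , root (F i))) (inj₁ tt)
    inside : ∀ i {a b} → E (F i) a b → NodeE (inj₂ (i , a)) (inj₂ (i , b))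

  Node : RGraph
  Node = record { graph = record { V = NodeV ; E = NodeE } ; root = inj₁ tt }

Node-map : ∀ {I} {F G : I → RGraph} → (∀ i → V (F i) → V (G i)) → NodeV F → NodeV G
Node-map φ (inj₁ tt) = inj₁ tt
Node-map φ (inj₂ (i , x)) = inj₂ (i , φ i x)

module _ {I : Set} {F G : I → RGraph} (φ : ∀ i → V (F i) → V (G i)) where

  Node-map-inverse : (ψ : ∀ i → V (G i) → V (F i)) → (∀ i x → ψ i (φ i x) ≡ x) →
                     ∀ x → Node-map {F = G} {F} ψ (Node-map {F = F} {G} φ x) ≡ x
  Node-map-inverse ψ inv (inj₁ tt) = refl
  Node-map-inverse ψ inv (inj₂ (i , x)) = cong (λ y → inj₂ (i , y)) (inv i x)

  Node-map-edge : (∀ i {a b} → E (F i) a b → E (G i) (φ i a) (φ i b)) →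
                  (∀ i → φ i (root (F i)) ≡ root (G i)) →
                  ∀ {a b} → NodeE F a b → NodeE G (Node-map {F = F} {G} φ a) (Node-map {F = F} {G} φ b)
  Node-map-edge edge root≡ (toRoot i) =
    subst (λ r → NodeE G (inj₂ (i , r)) (inj₁ tt)) (sym (root≡ i)) (toRoot i)
  Node-map-edge edge root≡ (inside i e) = inside i (edge i e)

Node-cong : ∀ {I} {F G : I → RGraph} → (∀ i → F i ≅ G i) → Node F ≅ Node G
Node-cong {F = F} {G} f =
  mk≅ (Node-map {F = F} {G} (_≅_.to ∘ f)) (Node-map {F = G} {F} (_≅_.from ∘ f))
    (Node-map-inverse _ _ (_≅_.from∘to ∘ f)) (Node-map-inverse _ _ (_≅_.to∘from ∘ f))
    (Node-map-edge _ (_≅_.edge⇒ ∘ f) (_≅_.root≡ ∘ f))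
    (Node-map-edge _ (_≅_.edge⇒ ∘ f⁻¹) (_≅_.root≡ ∘ f⁻¹))
    refl
  where f⁻¹ = λ i → ≅-sym (f i)

module _ {I J : Set} {G : J → RGraph} (e : I ↔ J) where
  open Inverse e using () renaming (to to reindex; from to unindex)

  private
    G′ : I → RGraph
    G′ = G ∘ reindex

    pull : ∀ j i → j ≡ reindex i → V (G j) → NodeV G′
    pull .(reindex i) i refl y = inj₂ (i , y)

    pull-toRoot : ∀ j i p → NodeE G′ (pull j i p (root (G j))) (inj₁ tt)
    pull-toRoot .(reindex i) i refl = toRoot i

    pull-inside : ∀ j i p {a b} → E (G j) a b → NodeE G′ (pull j i p a) (pull j i p b)
    pull-inside .(reindex i) i refl e = inside i e

    -- needs K: p : reindex i ≡ reindex i is matched against refl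
    pull-reindex : ∀ i i′ (q : i′ ≡ i) (p : reindex i ≡ reindex i′) x →
                   pull (reindex i) i′ p x ≡ inj₂ (i , x)
    pull-reindex i .i refl refl x = refl

  Node-reindex : Node G′ ≅ Node G
  Node-reindex = mk≅ to from from∘to to∘from to-edge from-edge refl
    where
      to : NodeV G′ → NodeV G
      to (inj₁ tt) = inj₁ tt
      to (inj₂ (i , x)) = inj₂ (reindex i , x)

      unindex-pulls : ∀ j → j ≡ reindex (unindex j)
      unindex-pulls j = sym (Inverse.strictlyInverseˡ e j)

      from : NodeV G → NodeV G′
      from (inj₁ tt) = inj₁ tt
      from (inj₂ (j , y)) = pull j (unindex j) (unindex-pulls j) y

      to-pull : ∀ j i p y → to (pull j i p y) ≡ inj₂ (j , y)
      to-pull .(reindex i) i refl y = refl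

      from∘to : ∀ x → from (to x) ≡ x
      from∘to (inj₁ tt) = refl
      from∘to (inj₂ (i , x)) =
        pull-reindex i _ (Inverse.strictlyInverseʳ e i) (unindex-pulls (reindex i)) x

      to∘from : ∀ y → to (from y) ≡ y
      to∘from (inj₁ tt) = refl
      to∘from (inj₂ (j , y)) = to-pull j _ _ y

      to-edge : ∀ {a b} → NodeE G′ a b → NodeE G (to a) (to b)
      to-edge (toRoot i) = toRoot (reindex i)
      to-edge (inside i e) = inside (reindex i) e

      from-edge : ∀ {a b} → NodeE G a b → NodeE G′ (from a) (from b)
      from-edge (toRoot j) = pull-toRoot j _ _
      from-edge (inside j e) = pull-inside j _ _ e

children : Tree → List Tree
children (node ts) = ts

Child : Tree → Set
Child t = Fin (length (children t))

child : (t : Tree) → Child t → Tree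
child t = lookup (children t)

treeR-Node : ∀ t → treeR t ≅ Node (treeR ∘ child t)
treeR-Node (node ts) = mk≅ to from from∘to to∘from to-edge from-edge refl
  where
    to : Pos (node ts) → NodeV (treeR ∘ child (node ts))
    to here = inj₁ tt
    to (below i p) = inj₂ (i , p)

    from : NodeV (treeR ∘ child (node ts)) → Pos (node ts)
    from (inj₁ tt) = here
    from (inj₂ (i , p)) = below i p

    from∘to : ∀ x → from (to x) ≡ x
    from∘to here = refl
    from∘to (below i p) = refl

    to∘from : ∀ y → to (from y) ≡ y
    to∘from (inj₁ tt) = refl
    to∘from (inj₂ (i , p)) = refl

    to-edge : ∀ {a b} → Edge a b → NodeE _ (to a) (to b)
    to-edge (toRoot i) = toRoot i
    to-edge (inside i e) = inside i e

    from-edge : ∀ {a b} → NodeE _ a b → Edge (from a) (from b)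
    from-edge (toRoot i) = toRoot i
    from-edge (inside i e) = inside i e

-- Restricted tensor products of trees

module _ {A : Set} {R : A → A → Set} where

  EqClosure-preserves : (P : A → Set) →
                        (∀ {x y} → R x y → P x → P y) → (∀ {x y} → R x y → P y → P x) →
                        ∀ {x y} → EqClosure R x y → P x → P y
  EqClosure-preserves P fwd-pres bwd-pres ε px = px
  EqClosure-preserves P fwd-pres bwd-pres (fwd r ◅ rs) px =
    EqClosure-preserves P fwd-pres bwd-pres rs (fwd-pres r px)
  EqClosure-preserves P fwd-pres bwd-pres (bwd r ◅ rs) px =
    EqClosure-preserves P fwd-pres bwd-pres rs (bwd-pres r px)

  reaches⇒connected : ∀ {x y} → Star R x y → EqClosure R y x
  reaches⇒connected path = EqClosure.symmetric R (Star.map fwd path)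

depth : ∀ {t} → Pos t → ℕ
depth here = 0
depth (below i p) = suc (depth p)

depth-rootPos : ∀ t → depth (rootPos t) ≡ 0
depth-rootPos (node _) = refl

Edge-depth : ∀ {t} {p q : Pos t} → Edge p q → depth p ≡ suc (depth q)
Edge-depth {node ts} (toRoot i) = cong suc (depth-rootPos (lookup ts i))
Edge-depth (inside i e) = cong suc (Edge-depth e)

TreeTensor : Tree → Tree → Graph
TreeTensor s t = treeGraph s ⊗ treeGraph t

⊗-connected⇒depth≡ : ∀ {s t p q} → EqClosure (Graph.E (TreeTensor s t)) (rootPos s , rootPos t) (p , q) →
                     depth p ≡ depth q
⊗-connected⇒depth≡ {s} {t} c =
  EqClosure-preserves (λ (p , q) → depth p ≡ depth q)
    (λ (e₁ , e₂) d → suc-injective (trans (sym (Edge-depth e₁)) (trans d (Edge-depth e₂))))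
    (λ (e₁ , e₂) d → trans (Edge-depth e₁) (trans (cong suc d) (sym (Edge-depth e₂))))
    c (trans (depth-rootPos s) (sym (depth-rootPos t)))

depth≡⇒reaches-root : ∀ {s t} (p : Pos s) (q : Pos t) → depth p ≡ depth q →
                      Star (Graph.E (TreeTensor s t)) (p , q) (rootPos s , rootPos t)
depth≡⇒reaches-root here here d = ε
depth≡⇒reaches-root (below i p) (below j q) d =
  Star.gmap (λ (p , q) → below i p , below j q) (λ (e₁ , e₂) → inside i e₁ , inside j e₂)
    (depth≡⇒reaches-root p q (suc-injective d))
  ◅◅ (toRoot i , toRoot j) ◅ ε

depth≡⇒⊗-connected : ∀ {s t} (p : Pos s) (q : Pos t) → depth p ≡ depth q →
                     EqClosure (Graph.E (TreeTensor s t)) (rootPos s , rootPos t) (p , q)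
depth≡⇒⊗-connected p q d = reaches⇒connected (depth≡⇒reaches-root p q d)

module ⊗̂-node (ss ts : List Tree) where

  F : Child (node ss) × Child (node ts) → RGraph
  F (a , b) = child (node ss) a ⊗̂ child (node ts) b

  Vertex : Set
  Vertex = CompV (TreeTensor (node ss) (node ts)) (here , here)

  to : Vertex → NodeV F
  to (cv (here , here) c) = inj₁ tt
  to (cv (below i p , below j q) c) =
    inj₂ ((i , j) , cv (p , q) (depth≡⇒⊗-connected p q (suc-injective (⊗-connected⇒depth≡ c))))
  to (cv (here , below j q) c) = Irrelevant.⊥-elim (0≢1+n (⊗-connected⇒depth≡ c))
  to (cv (below i p , here) c) = Irrelevant.⊥-elim (0≢1+n (sym (⊗-connected⇒depth≡ c)))

  from : NodeV F → Vertex
  from (inj₁ tt) = cv (here , here) ε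
  from (inj₂ ((i , j) , cv (p , q) c)) =
    cv (below i p , below j q) (depth≡⇒⊗-connected (below i p) (below j q) (cong suc (⊗-connected⇒depth≡ c)))

  from∘to : ∀ x → from (to x) ≡ x
  from∘to (cv (here , here) c) = refl
  from∘to (cv (below i p , below j q) c) = refl
  from∘to (cv (here , below j q) c) = Irrelevant.⊥-elim (0≢1+n (⊗-connected⇒depth≡ c))
  from∘to (cv (below i p , here) c) = Irrelevant.⊥-elim (0≢1+n (sym (⊗-connected⇒depth≡ c)))

  to∘from : ∀ y → to (from y) ≡ y
  to∘from (inj₁ tt) = refl
  to∘from (inj₂ ((i , j) , cv (p , q) c)) = refl

  to-edge : ∀ {a b : Vertex} → Graph.E (TreeTensor (node ss) (node ts)) (CompV.vtx a) (CompV.vtx b) →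
            NodeE F (to a) (to b)
  to-edge {cv _ _} {cv _ _} (toRoot i , toRoot j) = toRoot (i , j)
  to-edge {cv _ _} {cv _ _} (inside i e₁ , inside j e₂) = inside (i , j) (e₁ , e₂)
  to-edge {cv _ _} {cv _ c} (toRoot i , inside j e₂) = Irrelevant.⊥-elim (0≢1+n (⊗-connected⇒depth≡ c))
  to-edge {cv _ _} {cv _ c} (inside i e₁ , toRoot j) = Irrelevant.⊥-elim (0≢1+n (sym (⊗-connected⇒depth≡ c)))

  from-edge : ∀ {a b} → NodeE F a b →
              Graph.E (TreeTensor (node ss) (node ts)) (CompV.vtx (from a)) (CompV.vtx (from b))
  from-edge (toRoot (i , j)) = toRoot i , toRoot j
  from-edge {inj₂ (_ , cv _ _)} {inj₂ (_ , cv _ _)} (inside (i , j) (e₁ , e₂)) = inside i e₁ , inside j e₂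

⊗̂-Node : ∀ s t → (s ⊗̂ t) ≅ Node {Child s × Child t} (λ (a , b) → child s a ⊗̂ child t b)
⊗̂-Node (node ss) (node ts) = mk≅ to from from∘to to∘from to-edge from-edge refl
  where open ⊗̂-node ss ts

LoopTensor : Tree → Tree → Graph
LoopTensor s t = treeGraph s ⊗ loopGraph t

depth-rootPos-≤ : ∀ t {n} → depth (rootPos t) ≤ n
depth-rootPos-≤ t = subst (_≤ _) (sym (depth-rootPos t)) z≤n

module _ {s t : Tree} where

  ⊗ₗ-connected⇒depth≤ : ∀ {p q} → EqClosure (Graph.E (LoopTensor s t)) (rootPos s , rootPos t) (p , q) →
                        depth q ≤ depth p
  ⊗ₗ-connected⇒depth≤ c = EqClosure-preserves (λ (p , q) → depth q ≤ depth p) fwd-pres bwd-pres c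
    (depth-rootPos-≤ t)
    where
      fwd-pres : ∀ {x y} → Graph.E (LoopTensor s t) x y → depth (proj₂ x) ≤ depth (proj₁ x) →
                 depth (proj₂ y) ≤ depth (proj₁ y)
      fwd-pres (e₁ , inj₁ e₂) h = s≤s⁻¹ (subst₂ _≤_ (Edge-depth e₂) (Edge-depth e₁) h)
      fwd-pres (e₁ , inj₂ (_ , refl)) h = depth-rootPos-≤ t

      bwd-pres : ∀ {x y} → Graph.E (LoopTensor s t) x y → depth (proj₂ y) ≤ depth (proj₁ y) →
                 depth (proj₂ x) ≤ depth (proj₁ x)
      bwd-pres (e₁ , inj₁ e₂) h = subst₂ _≤_ (sym (Edge-depth e₂)) (sym (Edge-depth e₁)) (s≤s h)
      bwd-pres (e₁ , inj₂ (refl , _)) h = depth-rootPos-≤ t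

depth≤⇒reachesₗ-root : ∀ {s t} (p : Pos s) (q : Pos t) → depth q ≤ depth p →
                       Star (Graph.E (LoopTensor s t)) (p , q) (rootPos s , rootPos t)
depth≤⇒reachesₗ-root here here h = ε
depth≤⇒reachesₗ-root (below i p) here h =
  Star.gmap (λ (p , q) → below i p , q) (λ (e₁ , e₂) → inside i e₁ , e₂)
    (depth≤⇒reachesₗ-root p here z≤n)
  ◅◅ (toRoot i , inj₂ (refl , refl)) ◅ ε
depth≤⇒reachesₗ-root (below i p) (below j q) (s≤s h) with depth p ≟ depth q
... | yes d =
  Star.gmap (λ (p , q) → below i p , below j q) (λ (e₁ , e₂) → inside i e₁ , inj₁ (inside j e₂))
    (depth≡⇒reaches-root p q d)
  ◅◅ (toRoot i , inj₁ (toRoot j)) ◅ ε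
... | no d≢ =
  Star.gmap (λ (p , q) → below i p , q) (λ (e₁ , e₂) → inside i e₁ , e₂)
    (depth≤⇒reachesₗ-root p (below j q) (≤∧≢⇒< h (d≢ ∘ sym)))
  ◅◅ (toRoot i , inj₂ (refl , refl)) ◅ ε

depth≤⇒⊗ₗ-connected : ∀ {s t} (p : Pos s) (q : Pos t) → depth q ≤ depth p →
                      EqClosure (Graph.E (LoopTensor s t)) (rootPos s , rootPos t) (p , q)
depth≤⇒⊗ₗ-connected p q h = reaches⇒connected (depth≤⇒reachesₗ-root p q h)

module ⊗̂ₗ-node (ss ts : List Tree) where
  s t : Tree
  s = node ss
  t = node ts

  F : (Child s × Child t) ⊎ Child s → RGraph
  F = [ (λ (a , b) → child s a ⊗̂ child t b) , (λ a → child s a ⊗̂ₗ t) ]′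

  Vertex : Set
  Vertex = CompV (LoopTensor s t) (here , here)

  no-root-below : ∀ {j q} → .(depth (below {ts} j q) ≤ 0) → ∀ {X : Set} → X
  no-root-below ()

  -- (below i p , below j q) at equal depths lies in child i ⊗̂ child j; every other vertex below
  -- child i lies in child i ⊗̂ₗ t
  toBelow : ∀ i (p : Pos (child s i)) (q : Pos t) → .(depth q ≤ suc (depth p)) → NodeV F
  toBelow i p here h = inj₂ (inj₂ i , cv (p , here) (depth≤⇒⊗ₗ-connected p here z≤n))
  toBelow i p (below j q) h with depth p ≟ depth q
  ... | yes d = inj₂ (inj₁ (i , j) , cv (p , q) (depth≡⇒⊗-connected p q d))
  ... | no d≢ = inj₂ (inj₂ i , cv (p , below j q)
                       (depth≤⇒⊗ₗ-connected p (below j q) (≤∧≢⇒< (s≤s⁻¹ h) (d≢ ∘ sym))))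

  to : Vertex → NodeV F
  to (cv (here , here) c) = inj₁ tt
  to (cv (here , below j q) c) = no-root-below (⊗ₗ-connected⇒depth≤ c)
  to (cv (below i p , q) c) = toBelow i p q (⊗ₗ-connected⇒depth≤ c)

  from : NodeV F → Vertex
  from (inj₁ tt) = cv (here , here) ε
  from (inj₂ (inj₁ (i , j) , cv (p , q) c)) =
    cv (below i p , below j q)
       (depth≤⇒⊗ₗ-connected (below i p) (below j q) (s≤s (≤-reflexive (sym (⊗-connected⇒depth≡ c)))))
  from (inj₂ (inj₂ i , cv (p , q) c)) =
    cv (below i p , q) (depth≤⇒⊗ₗ-connected (below i p) q (m≤n⇒m≤1+n (⊗ₗ-connected⇒depth≤ c)))

  from∘to : ∀ x → from (to x) ≡ x
  from∘to (cv (here , here) c) = refl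
  from∘to (cv (here , below j q) c) = no-root-below (⊗ₗ-connected⇒depth≤ c)
  from∘to (cv (below i p , here) c) = refl
  from∘to (cv (below i p , below j q) c) with depth p ≟ depth q
  ... | yes _ = refl
  ... | no _ = refl

  to∘from : ∀ y → to (from y) ≡ y
  to∘from (inj₁ tt) = refl
  to∘from (inj₂ (inj₁ (i , j) , cv (p , q) c)) with depth p ≟ depth q
  ... | yes _ = refl
  ... | no d≢ = Irrelevant.⊥-elim (d≢ (⊗-connected⇒depth≡ c))
  to∘from (inj₂ (inj₂ i , cv (p , here) c)) = refl
  to∘from (inj₂ (inj₂ i , cv (p , below j q) c)) with depth p ≟ depth q
  ... | yes d = Irrelevant.⊥-elim (1+n≰n (subst (suc (depth q) ≤_) d (⊗ₗ-connected⇒depth≤ c)))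
  ... | no _ = refl

  to-edge : ∀ {a b : Vertex} → Graph.E (LoopTensor s t) (CompV.vtx a) (CompV.vtx b) → NodeE F (to a) (to b)
  to-edge {cv _ _} {cv _ _} (toRoot i , inj₂ (refl , refl)) = toRoot (inj₂ i)
  to-edge {cv _ _} {cv _ c} (toRoot i , inj₁ (inside j e)) = no-root-below (⊗ₗ-connected⇒depth≤ c)
  to-edge {cv _ _} {cv _ _} (toRoot i , inj₁ (toRoot j))
    with depth (rootPos (child s i)) ≟ depth (rootPos (child t j))
  ... | yes _ = toRoot (inj₁ (i , j))
  ... | no d≢ = ⊥-elim (d≢ (trans (depth-rootPos (child s i)) (sym (depth-rootPos (child t j)))))
  to-edge {cv _ _} {cv _ _} (inside i e , inj₂ (refl , refl)) = inside (inj₂ i) (e , inj₂ (refl , refl))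
  to-edge {cv (below i p , _) _} {cv _ _} (inside i e , inj₁ (toRoot j))
    with depth p ≟ depth (rootPos (child t j))
  ... | yes d = ⊥-elim (0≢1+n (trans (sym (trans d (depth-rootPos (child t j)))) (Edge-depth e)))
  ... | no _ = inside (inj₂ i) (e , inj₁ (toRoot j))
  to-edge {cv (below i p , below j q) _} {cv (below i p′ , below j q′) _} (inside i e , inj₁ (inside j f))
    with depth p ≟ depth q | depth p′ ≟ depth q′
  ... | yes _ | yes _ = inside (inj₁ (i , j)) (e , f)
  ... | no _ | no _ = inside (inj₂ i) (e , inj₁ (inside j f))
  ... | yes d | no d′≢ = ⊥-elim (d′≢ (suc-injective (trans (sym (Edge-depth e)) (trans d (Edge-depth f)))))
  ... | no d≢ | yes d′ = ⊥-elim (d≢ (trans (Edge-depth e) (trans (cong suc d′) (sym (Edge-depth f)))))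

  from-edge : ∀ {a b} → NodeE F a b → Graph.E (LoopTensor s t) (CompV.vtx (from a)) (CompV.vtx (from b))
  from-edge (toRoot (inj₁ (i , j))) = toRoot i , inj₁ (toRoot j)
  from-edge (toRoot (inj₂ i)) = toRoot i , inj₂ (refl , refl)
  from-edge {inj₂ (_ , cv _ _)} {inj₂ (_ , cv _ _)} (inside (inj₁ (i , j)) (e₁ , e₂)) = inside i e₁ , inj₁ (inside j e₂)
  from-edge {inj₂ (_ , cv _ _)} {inj₂ (_ , cv _ _)} (inside (inj₂ i) (e₁ , e₂)) = inside i e₁ , e₂

⊗̂ₗ-Node : ∀ s t → (s ⊗̂ₗ t) ≅ Node {(Child s × Child t) ⊎ Child s}
                                   [ (λ (a , b) → child s a ⊗̂ child t b) , (λ a → child s a ⊗̂ₗ t) ]′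
⊗̂ₗ-Node (node ss) (node ts) = mk≅ to from from∘to to∘from to-edge from-edge refl
  where open ⊗̂ₗ-node ss ts

-- Graded sets

-- A graded set stands for the forest with one tree T^k_W for each element of grade k.
record Graded : Set₁ where
  constructor graded
  field
    Carrier : Set
    grade : Carrier → ℕ
open Graded

record _≃_ (A B : Graded) : Set where
  field
    bijection : Carrier A ↔ Carrier B
    grade-preserving : ∀ x → grade B (Inverse.to bijection x) ≡ grade A x
open _≃_

_⊎ᵍ_ : Graded → Graded → Graded
A ⊎ᵍ B = graded (Carrier A ⊎ Carrier B) [ grade A , grade B ]′

_×ᵍ_ : Graded → Graded → Graded
A ×ᵍ B = graded (Carrier A × Carrier B) (λ (x , y) → grade A x ⊓ grade B y)

replicateᵍ : ℕ → ℕ → Graded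
replicateᵍ n k = graded (Fin n) (λ _ → k)

≃-refl : ∀ {A} → A ≃ A
≃-refl = record { bijection = ↔-refl ; grade-preserving = λ _ → refl }

≃-sym : ∀ {A B} → A ≃ B → B ≃ A
≃-sym {A} {B} f = record
  { bijection = ↔-sym (bijection f)
  ; grade-preserving = λ y → trans (sym (grade-preserving f _))
                                   (cong (grade B) (Inverse.strictlyInverseˡ (bijection f) y)) }

≃-trans : ∀ {A B C} → A ≃ B → B ≃ C → A ≃ C
≃-trans f g = record
  { bijection = ↔-trans (bijection f) (bijection g)
  ; grade-preserving = λ x → trans (grade-preserving g _) (grade-preserving f x) }

module ≃-Reasoning = SingleReasoning _≃_ ≃-refl ≃-trans

⊎ᵍ-cong : ∀ {A B C D} → A ≃ B → C ≃ D → (A ⊎ᵍ C) ≃ (B ⊎ᵍ D)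
⊎ᵍ-cong f g = record
  { bijection = ⊎-cong (bijection f) (bijection g)
  ; grade-preserving = λ { (inj₁ x) → grade-preserving f x ; (inj₂ y) → grade-preserving g y } }

×ᵍ-cong : ∀ {A B C D} → A ≃ B → C ≃ D → (A ×ᵍ C) ≃ (B ×ᵍ D)
×ᵍ-cong f g = record
  { bijection = ×-cong (bijection f) (bijection g)
  ; grade-preserving = λ (x , y) → cong₂ _⊓_ (grade-preserving f x) (grade-preserving g y) }

⊎ᵍ-assoc : ∀ {A B C} → ((A ⊎ᵍ B) ⊎ᵍ C) ≃ (A ⊎ᵍ (B ⊎ᵍ C))
⊎ᵍ-assoc = record
  { bijection = ⊎-assoc 0ℓ _ _ _
  ; grade-preserving = λ { (inj₁ (inj₁ _)) → refl ; (inj₁ (inj₂ _)) → refl ; (inj₂ _) → refl } }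

⊎ᵍ-comm : ∀ {A B} → (A ⊎ᵍ B) ≃ (B ⊎ᵍ A)
⊎ᵍ-comm = record
  { bijection = ⊎-comm _ _
  ; grade-preserving = λ { (inj₁ _) → refl ; (inj₂ _) → refl } }

×ᵍ-distribˡ-⊎ᵍ : ∀ {A B C} → (A ×ᵍ (B ⊎ᵍ C)) ≃ ((A ×ᵍ B) ⊎ᵍ (A ×ᵍ C))
×ᵍ-distribˡ-⊎ᵍ = record
  { bijection = ×-distribˡ-⊎ 0ℓ _ _ _
  ; grade-preserving = λ { (_ , inj₁ _) → refl ; (_ , inj₂ _) → refl } }

×ᵍ-distribʳ-⊎ᵍ : ∀ {A B C} → ((A ⊎ᵍ B) ×ᵍ C) ≃ ((A ×ᵍ C) ⊎ᵍ (B ×ᵍ C))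
×ᵍ-distribʳ-⊎ᵍ = record
  { bijection = ×-distribʳ-⊎ 0ℓ _ _ _
  ; grade-preserving = λ { (inj₁ _ , _) → refl ; (inj₂ _ , _) → refl } }

⊎ᵍ-replicateᵍ-0 : ∀ {A k} → (A ⊎ᵍ replicateᵍ 0 k) ≃ A
⊎ᵍ-replicateᵍ-0 = record
  { bijection = mk↔ₛ′ [ id , (λ ()) ]′ inj₁ (λ _ → refl) (λ { (inj₁ _) → refl ; (inj₂ ()) })
  ; grade-preserving = λ { (inj₁ _) → refl ; (inj₂ ()) } }

≡⇒Fin↔ : ∀ {m n} → m ≡ n → Fin m ↔ Fin n
≡⇒Fin↔ refl = ↔-refl

≃replicateᵍ : ∀ {A n k} → (∀ x → grade A x ≡ k) → Carrier A ↔ Fin n → A ≃ replicateᵍ n k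
≃replicateᵍ constant size = record { bijection = size ; grade-preserving = sym ∘ constant }

-- Children of T^k_W counted by height

-- w k stands for w_k (k ≥ 1); the value at 0 is never used.
NonIncreasing : (ℕ → ℕ) → Set
NonIncreasing w = ∀ k → w (suc (suc k)) ≤ w (suc k)

module _ (w : ℕ → ℕ) where

  -- the forests proj₂ (aux W k) and children (T^ W k)
  lowerGrades : ℕ → Graded
  lowerGrades zero = replicateᵍ 0 0
  lowerGrades (suc k) = lowerGrades k ⊎ᵍ replicateᵍ (w (suc k) ∸ w (suc (suc k))) k

  childGrades : ℕ → Graded
  childGrades zero = replicateᵍ 0 0
  childGrades (suc k) = replicateᵍ (w (suc k)) k ⊎ᵍ lowerGrades k

  -- the grades ≥ m among those of childGrades (suc (g + m))
  gradesFrom : ℕ → ℕ → Graded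
  gradesFrom m zero = replicateᵍ (w (suc m)) m
  gradesFrom m (suc g) = gradesFrom (suc m) g ⊎ᵍ replicateᵍ (w (suc m) ∸ w (suc (suc m))) m

  lowerGrades-< : ∀ k x → grade (lowerGrades k) x < k
  lowerGrades-< (suc k) (inj₁ x) = m<n⇒m<1+n (lowerGrades-< k x)
  lowerGrades-< (suc k) (inj₂ _) = n<1+n k

  childGrades-< : ∀ k x → grade (childGrades k) x < k
  childGrades-< (suc k) (inj₁ _) = n<1+n k
  childGrades-< (suc k) (inj₂ x) = m<n⇒m<1+n (lowerGrades-< k x)

  gradesFrom-≥ : ∀ m g x → m ≤ grade (gradesFrom m g) x
  gradesFrom-≥ m zero _ = ≤-refl
  gradesFrom-≥ m (suc g) (inj₁ x) = ≤-trans (n≤1+n m) (gradesFrom-≥ (suc m) g x)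
  gradesFrom-≥ m (suc g) (inj₂ _) = ≤-refl

  gradesFrom-size : NonIncreasing w → ∀ m g → Carrier (gradesFrom m g) ↔ Fin (w (suc m))
  gradesFrom-size w↓ m zero = ↔-refl
  gradesFrom-size w↓ m (suc g) =
    ↔-trans (⊎-cong (gradesFrom-size w↓ (suc m) g) ↔-refl)
      (↔-trans (↔-sym +↔⊎) (≡⇒Fin↔ (m+[n∸m]≡n (w↓ m))))

  gradesFrom-⊎-lowerGrades : ∀ m g → (gradesFrom m g ⊎ᵍ lowerGrades m) ≃ childGrades (suc (g + m))
  gradesFrom-⊎-lowerGrades m zero = ≃-refl
  gradesFrom-⊎-lowerGrades m (suc g) = begin
    (gradesFrom (suc m) g ⊎ᵍ replicateᵍ _ m) ⊎ᵍ lowerGrades m  ∼⟨ ⊎ᵍ-assoc ⟩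
    gradesFrom (suc m) g ⊎ᵍ (replicateᵍ _ m ⊎ᵍ lowerGrades m)  ∼⟨ ⊎ᵍ-cong ≃-refl ⊎ᵍ-comm ⟩
    gradesFrom (suc m) g ⊎ᵍ lowerGrades (suc m)                ∼⟨ gradesFrom-⊎-lowerGrades (suc m) g ⟩
    childGrades (suc (g + suc m))                              ≡⟨ cong (childGrades ∘ suc) (+-suc g m) ⟩
    childGrades (suc (suc g + m))                              ∎
    where open ≃-Reasoning

  childGrades≃gradesFrom : ∀ k → childGrades (suc k) ≃ gradesFrom 0 k
  childGrades≃gradesFrom k = ≃-sym (begin
    gradesFrom 0 k                        ∼⟨ ≃-sym ⊎ᵍ-replicateᵍ-0 ⟩
    gradesFrom 0 k ⊎ᵍ lowerGrades 0       ∼⟨ gradesFrom-⊎-lowerGrades 0 k ⟩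
    childGrades (suc (k + 0))             ≡⟨ cong (childGrades ∘ suc) (+-identityʳ k) ⟩
    childGrades (suc k)                   ∎)
    where open ≃-Reasoning

replicateᵍ-+ : ∀ {m n k} → (replicateᵍ m k ⊎ᵍ replicateᵍ n k) ≃ replicateᵍ (m + n) k
replicateᵍ-+ = ≃replicateᵍ (λ { (inj₁ _) → refl ; (inj₂ _) → refl }) (↔-sym +↔⊎)

×ᵍ-replicateᵍ-1 : ∀ {X k} → (∀ x → grade X x ≤ k) → (X ×ᵍ replicateᵍ 1 k) ≃ X
×ᵍ-replicateᵍ-1 bound = record
  { bijection = mk↔ₛ′ proj₁ (_, zero) (λ _ → refl) (λ { (_ , zero) → refl })
  ; grade-preserving = λ (x , _) → sym (m≤n⇒m⊓n≡m (bound x)) }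

empty≃ : ∀ {A k} → (Carrier A → Fin 0) → A ≃ replicateᵍ 0 k
empty≃ f = ≃replicateᵍ (λ x → ⊥-elim (¬Fin0 (f x))) (mk↔ₛ′ f (λ ()) (λ ()) (λ x → ⊥-elim (¬Fin0 (f x))))

*-∸-split : ∀ {a₁ a₂ b₁ b₂} → a₂ ≤ a₁ → b₂ ≤ b₁ →
            a₂ * (b₁ ∸ b₂) + (a₁ ∸ a₂) * b₁ ≡ b₁ * a₁ ∸ b₂ * a₂
*-∸-split {a₁} {a₂} {b₁} {b₂} a₂≤a₁ b₂≤b₁ = begin
  a₂ * y + x * b₁                          ≡⟨ m+n∸m≡n (b₂ * a₂) _ ⟨
  b₂ * a₂ + (a₂ * y + x * b₁) ∸ b₂ * a₂    ≡⟨ cong (_∸ b₂ * a₂) expand ⟩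
  b₁ * a₁ ∸ b₂ * a₂                        ∎
  where
    open ≡-Reasoning
    x = a₁ ∸ a₂
    y = b₁ ∸ b₂

    ring : ∀ a₂ x b₂ y → b₂ * a₂ + (a₂ * y + x * (b₂ + y)) ≡ (b₂ + y) * (a₂ + x)
    ring = solve-∀

    expand : b₂ * a₂ + (a₂ * y + x * b₁) ≡ b₁ * a₁
    expand = begin
      b₂ * a₂ + (a₂ * y + x * b₁)          ≡⟨ cong (λ b → b₂ * a₂ + (a₂ * y + x * b)) (m+[n∸m]≡n b₂≤b₁) ⟨
      b₂ * a₂ + (a₂ * y + x * (b₂ + y))    ≡⟨ ring a₂ x b₂ y ⟩
      (b₂ + y) * (a₂ + x)                  ≡⟨ cong₂ _*_ (m+[n∸m]≡n b₂≤b₁) (m+[n∸m]≡n a₂≤a₁) ⟩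
      b₁ * a₁                              ∎

module _ (v u c : ℕ → ℕ) (v↓ : NonIncreasing v) (u↓ : NonIncreasing u) (c≡uv : ∀ k → c k ≡ u k * v k) where

  private
    product-size : ∀ m → (Fin (v (suc m)) × Fin (u (suc m))) ↔ Fin (c (suc m))
    product-size m = ↔-trans (↔-sym *↔×) (≡⇒Fin↔ (trans (*-comm (v (suc m)) _) (sym (c≡uv (suc m)))))

  gradesFrom-×ᵍ : ∀ m a b → (gradesFrom v m a ×ᵍ gradesFrom u m b) ≃ gradesFrom c m (a ⊓ b)
  gradesFrom-×ᵍ m zero b =
    ≃replicateᵍ (λ (_ , y) → m≤n⇒m⊓n≡m (gradesFrom-≥ u m b y))
      (↔-trans (×-cong ↔-refl (gradesFrom-size u u↓ m b)) (product-size m))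
  gradesFrom-×ᵍ m (suc a) zero =
    ≃replicateᵍ (λ (x , _) → m≥n⇒m⊓n≡n (gradesFrom-≥ v m (suc a) x))
      (↔-trans (×-cong (gradesFrom-size v v↓ m (suc a)) ↔-refl) (product-size m))
  gradesFrom-×ᵍ m (suc a) (suc b) = begin
    (V₊ ⊎ᵍ Vₘ) ×ᵍ (U₊ ⊎ᵍ Uₘ)                 ∼⟨ ×ᵍ-distribʳ-⊎ᵍ ⟩
    (V₊ ×ᵍ (U₊ ⊎ᵍ Uₘ)) ⊎ᵍ (Vₘ ×ᵍ U)          ∼⟨ ⊎ᵍ-cong ×ᵍ-distribˡ-⊎ᵍ ≃-refl ⟩
    ((V₊ ×ᵍ U₊) ⊎ᵍ (V₊ ×ᵍ Uₘ)) ⊎ᵍ (Vₘ ×ᵍ U)  ∼⟨ ⊎ᵍ-assoc ⟩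
    (V₊ ×ᵍ U₊) ⊎ᵍ ((V₊ ×ᵍ Uₘ) ⊎ᵍ (Vₘ ×ᵍ U))  ∼⟨ ⊎ᵍ-cong (gradesFrom-×ᵍ (suc m) a b) minimum-m ⟩
    gradesFrom c m (suc (a ⊓ b))             ∎
    where
      open ≃-Reasoning
      V₊ = gradesFrom v (suc m) a
      Vₘ = replicateᵍ (v (suc m) ∸ v (suc (suc m))) m
      U₊ = gradesFrom u (suc m) b
      Uₘ = replicateᵍ (u (suc m) ∸ u (suc (suc m))) m
      U = U₊ ⊎ᵍ Uₘ

      -- there are v_{m+2}(u_{m+1} − u_{m+2}) + (v_{m+1} − v_{m+2})u_{m+1} = u_{m+1}v_{m+1} − u_{m+2}v_{m+2}
      -- pairs of minimal grade m
      minimum-m : ((V₊ ×ᵍ Uₘ) ⊎ᵍ (Vₘ ×ᵍ U)) ≃ replicateᵍ (c (suc m) ∸ c (suc (suc m))) m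
      minimum-m = ≃replicateᵍ
        (λ { (inj₁ (x , _)) → m≥n⇒m⊓n≡n (≤-trans (n≤1+n m) (gradesFrom-≥ v (suc m) a x))
           ; (inj₂ (_ , y)) → m≤n⇒m⊓n≡m (gradesFrom-≥ u m (suc b) y) })
        (↔-trans (⊎-cong (×-cong (gradesFrom-size v v↓ (suc m) a) ↔-refl)
                         (×-cong ↔-refl (gradesFrom-size u u↓ m (suc b))))
          (↔-trans (⊎-cong (↔-sym *↔×) (↔-sym *↔×))
            (↔-trans (↔-sym +↔⊎)
              (≡⇒Fin↔ (trans (*-∸-split (v↓ m) (u↓ m))
                             (sym (cong₂ _∸_ (c≡uv (suc m)) (c≡uv (suc (suc m))))))))))

  childGrades-×ᵍ : ∀ i j → (childGrades v i ×ᵍ childGrades u j) ≃ childGrades c (i ⊓ j)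
  childGrades-×ᵍ zero j = empty≃ proj₁
  childGrades-×ᵍ (suc i) zero = empty≃ proj₂
  childGrades-×ᵍ (suc i) (suc j) = begin
    childGrades v (suc i) ×ᵍ childGrades u (suc j)  ∼⟨ ×ᵍ-cong (childGrades≃gradesFrom v i) (childGrades≃gradesFrom u j) ⟩
    gradesFrom v 0 i ×ᵍ gradesFrom u 0 j            ∼⟨ gradesFrom-×ᵍ 0 i j ⟩
    gradesFrom c 0 (i ⊓ j)                          ∼⟨ ≃-sym (childGrades≃gradesFrom c (i ⊓ j)) ⟩
    childGrades c (suc (i ⊓ j))                     ∎
    where open ≃-Reasoning

-- Forests of trees T^k_W

module _ {A : Set} where

  split : (xs ys : List A) → Fin (length (xs ++ ys)) → Fin (length xs) ⊎ Fin (length ys)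
  split [] ys k = inj₂ k
  split (x ∷ xs) ys zero = inj₁ zero
  split (x ∷ xs) ys (suc k) = map₁ suc (split xs ys k)

  join : (xs ys : List A) → Fin (length xs) ⊎ Fin (length ys) → Fin (length (xs ++ ys))
  join [] ys (inj₂ k) = k
  join (x ∷ xs) ys (inj₁ zero) = zero
  join (x ∷ xs) ys (inj₁ (suc k)) = suc (join xs ys (inj₁ k))
  join (x ∷ xs) ys (inj₂ k) = suc (join xs ys (inj₂ k))

  split-join : ∀ xs ys k → split xs ys (join xs ys k) ≡ k
  split-join [] ys (inj₂ k) = refl
  split-join (x ∷ xs) ys (inj₁ zero) = refl
  split-join (x ∷ xs) ys (inj₁ (suc k)) = cong (map₁ suc) (split-join xs ys (inj₁ k))
  split-join (x ∷ xs) ys (inj₂ k) = cong (map₁ suc) (split-join xs ys (inj₂ k))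

  join-map₁-suc : ∀ x xs ys k → join (x ∷ xs) ys (map₁ suc k) ≡ suc (join xs ys k)
  join-map₁-suc x xs ys (inj₁ k) = refl
  join-map₁-suc x xs ys (inj₂ k) = refl

  join-split : ∀ xs ys k → join xs ys (split xs ys k) ≡ k
  join-split [] ys k = refl
  join-split (x ∷ xs) ys zero = refl
  join-split (x ∷ xs) ys (suc k) =
    trans (join-map₁-suc x xs ys (split xs ys k)) (cong suc (join-split xs ys k))

  ++-index : (xs ys : List A) → Fin (length (xs ++ ys)) ↔ (Fin (length xs) ⊎ Fin (length ys))
  ++-index xs ys = mk↔ₛ′ (split xs ys) (join xs ys) (split-join xs ys) (join-split xs ys)

  lookup-++ : ∀ xs ys k → lookup (xs ++ ys) k ≡ [ lookup xs , lookup ys ]′ (split xs ys k)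
  lookup-++ [] ys k = refl
  lookup-++ (x ∷ xs) ys zero = refl
  lookup-++ (x ∷ xs) ys (suc k) = trans (lookup-++ xs ys k) (sym ([,]-map (split xs ys k)))

  lookup-replicate : ∀ n (y : A) k → lookup (replicate n y) k ≡ y
  lookup-replicate (suc n) y zero = refl
  lookup-replicate (suc n) y (suc k) = lookup-replicate n y k

record Realises {d} (W : Vec ℕ d) (ts : List Tree) (X : Graded) : Set where
  field
    index : Fin (length ts) ↔ Carrier X
    lookup≡T^ : ∀ a → lookup ts a ≡ T^ W (grade X (Inverse.to index a))
open Realises

module _ {d} (W : Vec ℕ d) where

  Realises-++ : ∀ {xs ys X Y} → Realises W xs X → Realises W ys Y → Realises W (xs ++ ys) (X ⊎ᵍ Y)
  Realises-++ {xs} {ys} rx ry = record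
    { index = ↔-trans (++-index xs ys) (⊎-cong (index rx) (index ry))
    ; lookup≡T^ = λ k → trans (lookup-++ xs ys k) (lookup≡T^-split (split xs ys k)) }
    where
      lookup≡T^-split : ∀ k → [ lookup xs , lookup ys ]′ k ≡
                              T^ W ([ grade _ , grade _ ]′ (Sum.map (Inverse.to (index rx)) (Inverse.to (index ry)) k))
      lookup≡T^-split (inj₁ a) = lookup≡T^ rx a
      lookup≡T^-split (inj₂ b) = lookup≡T^ ry b

  Realises-replicate : ∀ n k → Realises W (replicate n (T^ W k)) (replicateᵍ n k)
  Realises-replicate n k = record
    { index = ≡⇒Fin↔ (length-replicate n)
    ; lookup≡T^ = lookup-replicate n (T^ W k) }

  realises-lowerGrades : ∀ k → Realises W (proj₂ (aux W k)) (lowerGrades (W at_) k)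
  realises-lowerGrades zero = record { index = ↔-refl ; lookup≡T^ = λ () }
  realises-lowerGrades (suc k) = Realises-++ (realises-lowerGrades k) (Realises-replicate _ k)

  realises-childGrades : ∀ k → Realises W (children (T^ W k)) (childGrades (W at_) k)
  realises-childGrades zero = record { index = ↔-refl ; lookup≡T^ = λ () }
  realises-childGrades (suc k) = Realises-++ (Realises-replicate _ k) (realises-lowerGrades k)

Node-realised : ∀ {d} {W : Vec ℕ d} {t X I} {F : I → RGraph} → Realises W (children t) X →
                (e : I ↔ Carrier X) → (∀ i → F i ≅ treeR (T^ W (grade X (Inverse.to e i)))) →
                Node F ≅ treeR t
Node-realised {W = W} {t} {X} {F = F} r e F≅ = begin
  Node F                          ∼⟨ Node-cong F≅ ⟩
  Node (G ∘ Inverse.to e)         ∼⟨ Node-reindex e ⟩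
  Node G                          ∼⟨ ≅-sym (Node-reindex (index r)) ⟩
  Node (G ∘ Inverse.to (index r)) ∼⟨ Node-cong (λ a → ≡⇒≅ (cong treeR (sym (lookup≡T^ r a)))) ⟩
  Node (treeR ∘ child t)          ∼⟨ ≅-sym (treeR-Node t) ⟩
  treeR t                         ∎
  where
    open ≅-Reasoning
    G : Carrier X → RGraph
    G = treeR ∘ T^ W ∘ grade X

module _ {d} (V U K : Vec ℕ d) (V↓ : NonIncreasing (V at_)) (U↓ : NonIncreasing (U at_))
         (K≡UV : ∀ k → K at k ≡ U at k * V at k) where

  T^-⊗̂-T^ : ∀ i j → (T^ V i ⊗̂ T^ U j) ≅ treeR (T^ K (i ⊓ j))
  T^-⊗̂-T^ = <-rec _ step
    where
      step : ∀ i → (∀ {i′} → i′ < i → ∀ j → (T^ V i′ ⊗̂ T^ U j) ≅ treeR (T^ K (i′ ⊓ j))) →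
             ∀ j → (T^ V i ⊗̂ T^ U j) ≅ treeR (T^ K (i ⊓ j))
      step i rec j = begin
        T^ V i ⊗̂ T^ U j       ∼⟨ ⊗̂-Node (T^ V i) (T^ U j) ⟩
        Node _                ∼⟨ Node-realised (realises-childGrades K (i ⊓ j)) pairing pair ⟩
        treeR (T^ K (i ⊓ j))  ∎
        where
          open ≅-Reasoning
          RV = realises-childGrades V i
          RU = realises-childGrades U j
          product = childGrades-×ᵍ (V at_) (U at_) (K at_) V↓ U↓ K≡UV i j
          pairing = ↔-trans (×-cong (index RV) (index RU)) (bijection product)

          pair : ∀ ab → (child (T^ V i) (proj₁ ab) ⊗̂ child (T^ U j) (proj₂ ab)) ≅
                        treeR (T^ K (grade (childGrades (K at_) (i ⊓ j)) (Inverse.to pairing ab)))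
          pair (a , b) = begin
            child (T^ V i) a ⊗̂ child (T^ U j) b  ≡⟨ cong₂ _⊗̂_ (lookup≡T^ RV a) (lookup≡T^ RU b) ⟩
            T^ V g ⊗̂ T^ U h                      ∼⟨ rec (childGrades-< (V at_) i x) h ⟩
            treeR (T^ K (g ⊓ h))                 ≡⟨ cong (treeR ∘ T^ K) (grade-preserving product (x , y)) ⟨
            treeR (T^ K (grade (childGrades (K at_) (i ⊓ j)) (Inverse.to pairing (a , b)))) ∎
            where
              x = Inverse.to (index RV) a
              y = Inverse.to (index RU) b
              g = grade (childGrades (V at_) i) x
              h = grade (childGrades (U at_) j) y

module _ {d} (V U K : Vec ℕ (suc d)) (V↓ : NonIncreasing (V at_)) (U↓ : NonIncreasing (U at_))
         (K≡UV : ∀ k → K at k ≡ U at k * V at k) (U-positive : 1 ≤ U at suc d) where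

  private
    v = V at_
    u = U at_
    c = K at_

    T_-grades : Graded
    T_-grades = replicateᵍ (u (suc d) ∸ 1) d ⊎ᵍ lowerGrades u d

    realises-T_-grades : Realises U (children (T_ U)) T_-grades
    realises-T_-grades = Realises-++ U (Realises-replicate U _ d) (realises-lowerGrades U d)

    -- the loop at the root of T_U stands in for the missing (u_{d+1})-th copy of T^d_U
    T_-grades⊎loop : (T_-grades ⊎ᵍ replicateᵍ 1 d) ≃ childGrades u (suc d)
    T_-grades⊎loop = begin
      (R ⊎ᵍ lowerGrades u d) ⊎ᵍ replicateᵍ 1 d    ∼⟨ ⊎ᵍ-assoc ⟩
      R ⊎ᵍ (lowerGrades u d ⊎ᵍ replicateᵍ 1 d)    ∼⟨ ⊎ᵍ-cong ≃-refl ⊎ᵍ-comm ⟩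
      R ⊎ᵍ (replicateᵍ 1 d ⊎ᵍ lowerGrades u d)    ∼⟨ ≃-sym ⊎ᵍ-assoc ⟩
      (R ⊎ᵍ replicateᵍ 1 d) ⊎ᵍ lowerGrades u d    ∼⟨ ⊎ᵍ-cong replicateᵍ-+ ≃-refl ⟩
      replicateᵍ (u (suc d) ∸ 1 + 1) d ⊎ᵍ lowerGrades u d
        ≡⟨ cong (λ n → replicateᵍ n d ⊎ᵍ lowerGrades u d) (m∸n+n≡m U-positive) ⟩
      childGrades u (suc d)                       ∎
      where
        open ≃-Reasoning
        R = replicateᵍ (u (suc d) ∸ 1) d

    loop-grades : ∀ i → i ≤ suc d → ((childGrades v i ×ᵍ T_-grades) ⊎ᵍ childGrades v i) ≃ childGrades c i
    loop-grades i i≤ = begin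
      (C ×ᵍ T_-grades) ⊎ᵍ C                       ∼⟨ ⊎ᵍ-cong ≃-refl (≃-sym (×ᵍ-replicateᵍ-1 ≤d)) ⟩
      (C ×ᵍ T_-grades) ⊎ᵍ (C ×ᵍ replicateᵍ 1 d)   ∼⟨ ≃-sym ×ᵍ-distribˡ-⊎ᵍ ⟩
      C ×ᵍ (T_-grades ⊎ᵍ replicateᵍ 1 d)          ∼⟨ ×ᵍ-cong ≃-refl T_-grades⊎loop ⟩
      C ×ᵍ childGrades u (suc d)                  ∼⟨ childGrades-×ᵍ v u c V↓ U↓ K≡UV i (suc d) ⟩
      childGrades c (i ⊓ suc d)                   ≡⟨ cong (childGrades c) (m≤n⇒m⊓n≡m i≤) ⟩
      childGrades c i                             ∎
      where
        open ≃-Reasoning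
        C = childGrades v i
        ≤d : ∀ x → grade C x ≤ d
        ≤d x = s≤s⁻¹ (≤-trans (childGrades-< v i x) i≤)

  T^-⊗̂ₗ-T_ : ∀ i → i ≤ suc d → (T^ V i ⊗̂ₗ T_ U) ≅ treeR (T^ K i)
  T^-⊗̂ₗ-T_ = <-rec _ step
    where
      step : ∀ i → (∀ {i′} → i′ < i → i′ ≤ suc d → (T^ V i′ ⊗̂ₗ T_ U) ≅ treeR (T^ K i′)) →
             i ≤ suc d → (T^ V i ⊗̂ₗ T_ U) ≅ treeR (T^ K i)
      step i rec i≤ = begin
        T^ V i ⊗̂ₗ T_ U   ∼⟨ ⊗̂ₗ-Node (T^ V i) (T_ U) ⟩
        Node _           ∼⟨ Node-realised (realises-childGrades K i) pairing pair ⟩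
        treeR (T^ K i)   ∎
        where
          open ≅-Reasoning
          RV = realises-childGrades V i
          RT = realises-T_-grades
          grades = loop-grades i i≤
          pairing = ↔-trans (⊎-cong (×-cong (index RV) (index RT)) (index RV)) (bijection grades)

          pair : ∀ ab → [ (λ (a , b) → child (T^ V i) a ⊗̂ child (T_ U) b) , (λ a → child (T^ V i) a ⊗̂ₗ T_ U) ]′ ab ≅
                        treeR (T^ K (grade (childGrades c i) (Inverse.to pairing ab)))
          pair (inj₁ (a , b)) = begin
            child (T^ V i) a ⊗̂ child (T_ U) b  ≡⟨ cong₂ _⊗̂_ (lookup≡T^ RV a) (lookup≡T^ RT b) ⟩
            T^ V g ⊗̂ T^ U h                    ∼⟨ T^-⊗̂-T^ V U K V↓ U↓ K≡UV g h ⟩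
            treeR (T^ K (g ⊓ h))               ≡⟨ cong (treeR ∘ T^ K) (grade-preserving grades (inj₁ (x , y))) ⟨
            treeR (T^ K (grade (childGrades c i) (Inverse.to pairing (inj₁ (a , b))))) ∎
            where
              x = Inverse.to (index RV) a
              y = Inverse.to (index RT) b
              g = grade (childGrades v i) x
              h = grade T_-grades y
          pair (inj₂ a) = begin
            child (T^ V i) a ⊗̂ₗ T_ U   ≡⟨ cong (_⊗̂ₗ T_ U) (lookup≡T^ RV a) ⟩
            T^ V g ⊗̂ₗ T_ U             ∼⟨ rec g<i (<⇒≤ (≤-trans g<i i≤)) ⟩
            treeR (T^ K g)             ≡⟨ cong (treeR ∘ T^ K) (grade-preserving grades (inj₂ x)) ⟨
            treeR (T^ K (grade (childGrades c i) (Inverse.to pairing (inj₂ a)))) ∎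
            where
              x = Inverse.to (index RV) a
              g = grade (childGrades v i) x
              g<i = childGrades-< v i x

at-nonIncreasing : ∀ {d} (W : Vec ℕ d) → Linked _≥_ W → NonIncreasing (W at_)
at-nonIncreasing [] _ k = z≤n
at-nonIncreasing (w ∷ []) _ k = z≤n
at-nonIncreasing (w ∷ w′ ∷ W) (w≥w′ ∷ _) zero = w≥w′
at-nonIncreasing (w ∷ w′ ∷ W) (_ ∷ W↓) (suc k) = at-nonIncreasing (w′ ∷ W) W↓ k

at-last-positive : ∀ {d} (W : Vec ℕ (suc d)) → All (0 <_) W → 1 ≤ W at suc d
at-last-positive (w ∷ []) (w>0 ∷ _) = w>0
at-last-positive (w ∷ w′ ∷ W) (_ ∷ W>0) = at-last-positive (w′ ∷ W) W>0

·-at : ∀ {d} (U V : Vec ℕ d) k → (U · V) at k ≡ U at k * V at k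
·-at [] [] k = refl
·-at (u ∷ U) (v ∷ V) zero = refl
·-at (u ∷ U) (v ∷ V) (suc zero) = refl
·-at (u ∷ U) (v ∷ V) (suc (suc k)) = ·-at U V (suc k)

lemma2p9 :
    ((d : ℕ) (V U : Vec ℕ d) → NonIncPos V → NonIncPos U →
      (i j : ℕ) → i ≤ d → j ≤ d →
      (T^ V i ⊗̂ T^ U j) ≅ treeR (T^ (U · V) (i ⊓ j)))
    ×
    ((d : ℕ) (V U : Vec ℕ (suc d)) → NonIncPos V → NonIncPos U →
      (i : ℕ) → i ≤ suc d →
      ((T^ V i ⊗̂ₗ T_ U) ≅ treeR (T^ (U · V) i))
      × ((T^ U i ⊗̂ₗ T_ V) ≅ treeR (T^ (U · V) i)))
lemma2p9 =
  -- part (i) holds for all i and j: past d the sequences continue by zeros and stay non-increasing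
  (λ d V U (_ , V↓) (_ , U↓) i j _ _ →
    T^-⊗̂-T^ V U (U · V) (at-nonIncreasing V V↓) (at-nonIncreasing U U↓) (·-at U V) i j) ,
  (λ d V U (V>0 , V↓) (U>0 , U↓) i i≤ →
    T^-⊗̂ₗ-T_ V U (U · V) (at-nonIncreasing V V↓) (at-nonIncreasing U U↓)
      (·-at U V) (at-last-positive U U>0) i i≤ ,
    T^-⊗̂ₗ-T_ U V (U · V) (at-nonIncreasing U U↓) (at-nonIncreasing V V↓)
      (λ k → trans (·-at U V k) (*-comm (U at k) (V at k))) (at-last-positive V V>0) i i≤)
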